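{- Let $\{q_n\}$ be the Fibonacci Quilt sequence and $m$ a positive integer. If $\mathcal{D}(m)$ is any decomposition $m=c_1q_1+c_2q_2+\cdots+c_nq_n$ with $c_i\in\{0,1,2,\dots\}$ (not necessarily FQ-legal), and its number of summands is $c_1+\cdots+c_n$, then the number of summands of the Greedy-6 decomposition $\mathcal{G}(m)$ is at most the number of summands of $\mathcal{D}(m)$.
   Context: Given an increasing sequence of positive integers $\{q_i\}_{i\ge1}$, a decomposition $m=q_{\ell_1}+\cdots+q_{\ell_t}$ with $q_{\ell_1}>\cdots>q_{\ell_t}$ is FQ-legal if $|\ell_i-\ell_j|\notin\{0,1,3,4\}$ for all $i\neq j$ and $\{1,3\}\not\subset\{\ell_1,\dots,\ell_t\}$. The Fibonacci Quilt sequence is the increasing sequence $\{q_i\}_{i\ge1}$ of positive integers in which each $q_i$ is the smallest positive integer with no FQ-legal decomposition using elements of $\{q_1,\dots,q_{i-1}\}$ (so it begins $1,2,3,4,5,7,9,12,16,\dots$). The Greedy-6 decomposition $\mathcal{G}(m)$ of a positive integer $m$ is defined recursively: if $m=q_n$ for some $n$, then $\mathcal{G}(m)=q_n$; if $m=6$, then $\mathcal{G}(m)=q_4+q_2$; otherwise write $m=q_{\ell_1}+x$ where $q_{\ell_1}<m<q_{\ell_1+1}$ and $x>0$, and set $\mathcal{G}(m)=q_{\ell_1}+\mathcal{G}(x)$. Its number of summands is the number of terms in this sum. -}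

module Defs where

open import Data.Nat using (ℕ; zero; suc; _+_; _*_; _∸_; _<_; _≤_; ∣_-_∣)
open import Data.List using (List; []; _∷_; map)
open import Data.Nat.ListAction using (sum)
open import Data.List.Relation.Unary.All using (All)
open import Data.List.Relation.Unary.AllPairs using (AllPairs)
open import Data.List.Membership.Propositional using (_∈_)
open import Data.Product using (Σ; _×_; ∃-syntax)
open import Relation.Binary.PropositionalEquality using (_≡_; _≢_)
open import Relation.Nullary using (¬_)

-- Convention: sequences are 0-indexed in Agda, i.e. q 0 = q_1, q 1 = q_2, ...
-- An index list L represents the decomposition  sum of q ℓ for ℓ ∈ L.

GoodGap : ℕ → ℕ → Set
GoodGap a b = (∣ a - b ∣ ≢ 0) × (∣ a - b ∣ ≢ 1) × (∣ a - b ∣ ≢ 3) × (∣ a - b ∣ ≢ 4)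

-- FQ-legality of an index list (paper's {1,3} becomes {0,2} in 0-based indexing)
FQLegal : List ℕ → Set
FQLegal L = AllPairs GoodGap L × ¬ ((0 ∈ L) × (2 ∈ L))

HasFQDec : (ℕ → ℕ) → ℕ → ℕ → Set
HasFQDec q i m = Σ (List ℕ) λ L → All (_< i) L × FQLegal L × sum (map q L) ≡ m

IsFibonacciQuilt : (ℕ → ℕ) → Set
IsFibonacciQuilt q = (i : ℕ) →
  (0 < q i) × ¬ HasFQDec q i (q i) ×
  ((m : ℕ) → 0 < m → m < q i → HasFQDec q i m)

-- Greedy-6 decomposition:  Greedy6 q m k  means  G(m) has k summands.
data Greedy6 (q : ℕ → ℕ) : ℕ → ℕ → Set where
  g-term : ∀ {m} n → q n ≡ m → Greedy6 q m 1
  g-six  : (∀ n → q n ≢ 6) → Greedy6 q 6 2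
  g-step : ∀ {m k} ℓ → (∀ n → q n ≢ m) → m ≢ 6 →
           q ℓ < m → m < q (suc ℓ) →
           Greedy6 q (m ∸ q ℓ) k → Greedy6 q m (suc k)

decValue : (ℕ → ℕ) → ℕ → List ℕ → ℕ
decValue q k [] = 0
decValue q k (c ∷ cs) = c * q k + decValue q (suc k) cs

module Submission where

-- The Fibonacci Quilt sequence is the explicit sequence Q below; q i = Q i by induction on i.
-- Every m > 0 has an FQ-legal decomposition into terms Q ℓ ≤ m (take the largest term and recurse,
-- with 6 = Q 3 + Q 1 the only exception), so q i ≮ Q i; and no FQ-legal decomposition with indices
-- below i sums to Q i (a case analysis on its top indices, using Q (n + 5) = Q (n + 4) + Q n),
-- so q i ≯ Q i.
-- Adding one summand Q j to x raises the greedy count by at most one: either j is at least 5 above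
-- the greedy top p of x and Q j becomes the new top, or Q p + Q j equals one term or two terms the
-- smaller of which has index below p, and the induction hypothesis applies twice.  Adding the
-- summands of an arbitrary decomposition one at a time bounds the greedy count by their number.
-- The greedy count used here ignores the special rule for 6, which only replaces 5 + 1 by 4 + 2.

open import Defs
open import Data.Nat
open import Data.Nat.Properties
open import Data.Nat.Induction using (<-rec)
open import Data.Nat.ListAction using (sum)
open import Data.Nat.Tactic.RingSolver using (solve-∀)
open import Data.Bool using (Bool; true; false; if_then_else_; _∨_)
open import Data.Empty using (⊥-elim)
open import Data.List using (List; []; _∷_; map)
open import Data.List.Relation.Unary.All as All using (All; []; _∷_)
open import Data.List.Relation.Unary.AllPairs using (AllPairs; []; _∷_)
open import Data.List.Relation.Unary.Any using (here; there)
open import Data.List.Membership.Propositional using (_∈_)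
open import Data.List.Membership.DecPropositional _≟_ using (_∈?_)
open import Data.Product using (Σ; _×_; _,_; proj₁; proj₂; ∃-syntax)
open import Data.Sum using (_⊎_; inj₁; inj₂)
open import Function using (_∘_)
open import Relation.Binary.Definitions using (tri<; tri≈; tri>)
open import Relation.Binary.PropositionalEquality
open import Relation.Nullary using (¬_; yes; no)
open import Relation.Nullary.Decidable using (does; dec-true; dec-false)

-- The sequence Q

Q : ℕ → ℕ
Q 0 = 1
Q 1 = 2
Q 2 = 3
Q 3 = 4
Q (suc (suc (suc (suc n)))) = Q (suc (suc n)) + Q (suc n)

Q-<-suc : ∀ n → Q n < Q (suc n)
Q-<-suc 0 = ≤-refl
Q-<-suc 1 = ≤-refl
Q-<-suc 2 = ≤-refl
Q-<-suc 3 = ≤-refl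
Q-<-suc (suc (suc (suc (suc n)))) = begin-strict
  Q (2 + n) + Q (1 + n) <⟨ +-monoʳ-< (Q (2 + n)) (<-trans (Q-<-suc (suc n)) (Q-<-suc (suc (suc n)))) ⟩
  Q (2 + n) + Q (3 + n) ≡⟨ +-comm (Q (2 + n)) (Q (3 + n)) ⟩
  Q (3 + n) + Q (2 + n) ∎
  where open ≤-Reasoning

Q-strictMono : ∀ {m n} → m < n → Q m < Q n
Q-strictMono {m} {suc n} (s≤s m≤n) with m≤n⇒m<n∨m≡n m≤n
... | inj₁ m<n = <-trans (Q-strictMono m<n) (Q-<-suc n)
... | inj₂ refl = Q-<-suc m

Q-mono : ∀ {m n} → m ≤ n → Q m ≤ Q n
Q-mono {m} m≤n with m≤n⇒m<n∨m≡n m≤n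
... | inj₁ m<n = <⇒≤ (Q-strictMono m<n)
... | inj₂ refl = ≤-refl

Q-cancel-< : ∀ m n → Q m < Q n → m < n
Q-cancel-< m n Qm<Qn with <-cmp m n
... | tri< m<n _ _ = m<n
... | tri≈ _ refl _ = ⊥-elim (<-irrefl refl Qm<Qn)
... | tri> _ _ n<m = ⊥-elim (<-asym Qm<Qn (Q-strictMono n<m))

Q-pos : ∀ n → 1 ≤ Q n
Q-pos n = Q-mono {0} {n} z≤n

Q-bracket-unique : ∀ {y ℓ ℓ′} → Q ℓ ≤ y → y < Q (suc ℓ) → Q ℓ′ ≤ y → y < Q (suc ℓ′) → ℓ ≡ ℓ′
Q-bracket-unique {ℓ = ℓ} {ℓ′} Qℓ≤y y<Qℓ+1 Qℓ′≤y y<Qℓ′+1 with <-cmp ℓ ℓ′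
... | tri< ℓ<ℓ′ _ _ = ⊥-elim (<⇒≱ y<Qℓ+1 (≤-trans (Q-mono ℓ<ℓ′) Qℓ′≤y))
... | tri≈ _ ℓ≡ℓ′ _ = ℓ≡ℓ′
... | tri> _ _ ℓ′<ℓ = ⊥-elim (<⇒≱ y<Qℓ′+1 (≤-trans (Q-mono ℓ′<ℓ) Qℓ≤y))

Q-bracket : ∀ y → 1 ≤ y → ∃[ ℓ ] (Q ℓ ≤ y × y < Q (suc ℓ))
Q-bracket 1 _ = 0 , ≤-refl , ≤-refl
Q-bracket (suc (suc y)) _ with Q-bracket (suc y) (s≤s z≤n)
... | ℓ , Qℓ≤y , y<Qℓ+1 with m≤n⇒m<n∨m≡n y<Qℓ+1
...   | inj₁ y+1<Qℓ+1 = ℓ , m≤n⇒m≤1+n Qℓ≤y , y+1<Qℓ+1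
...   | inj₂ y+1≡Qℓ+1 =
  suc ℓ , ≤-reflexive (sym y+1≡Qℓ+1) , subst (_< Q (2 + ℓ)) (sym y+1≡Qℓ+1) (Q-<-suc (suc ℓ))

-- Q (k + n) unfolds definitionally into a linear combination of Q (1 + n), Q (2 + n), Q (3 + n),
-- so each identity below is a semiring identity in those three values.
Q[6+n]≡Q[5+n]+Q[1+n] : ∀ n → Q (6 + n) ≡ Q (5 + n) + Q (1 + n)
Q[6+n]≡Q[5+n]+Q[1+n] n = identity (Q (1 + n)) (Q (2 + n)) (Q (3 + n))
  where
  identity : ∀ a b c → (b + a) + c ≡ (c + b) + a
  identity = solve-∀

Q[6+n]+Q[6+n]≡Q[8+n]+Q[1+n] : ∀ n → Q (6 + n) + Q (6 + n) ≡ Q (8 + n) + Q (1 + n)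
Q[6+n]+Q[6+n]≡Q[8+n]+Q[1+n] n = identity (Q (1 + n)) (Q (2 + n)) (Q (3 + n))
  where
  identity : ∀ a b c → ((b + a) + c) + ((b + a) + c) ≡ (((b + a) + c) + (c + b)) + a
  identity = solve-∀

Q[4+n]+Q[6+n]≡Q[7+n]+Q[1+n] : ∀ n → Q (4 + n) + Q (6 + n) ≡ Q (7 + n) + Q (1 + n)
Q[4+n]+Q[6+n]≡Q[7+n]+Q[1+n] n = identity (Q (1 + n)) (Q (2 + n)) (Q (3 + n))
  where
  identity : ∀ a b c → (b + a) + ((b + a) + c) ≡ ((c + b) + (b + a)) + a
  identity = solve-∀

Q[6+n]+Q[9+n]≡Q[10+n]+Q[1+n] : ∀ n → Q (6 + n) + Q (9 + n) ≡ Q (10 + n) + Q (1 + n)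
Q[6+n]+Q[9+n]≡Q[10+n]+Q[1+n] n = identity (Q (1 + n)) (Q (2 + n)) (Q (3 + n))
  where
  identity : ∀ a b c →
    ((b + a) + c) + (((c + b) + (b + a)) + ((b + a) + c)) ≡
    ((((b + a) + c) + (c + b)) + ((c + b) + (b + a))) + a
  identity = solve-∀

-- Greedy decompositions

data Greedy : ℕ → ℕ → Set where
  greedy-zero : Greedy 0 0
  greedy-step : ∀ {y k} ℓ → Q ℓ ≤ y → y < Q (suc ℓ) → Greedy (y ∸ Q ℓ) k → Greedy y (suc k)

Greedy-unique : ∀ {y k k′} → Greedy y k → Greedy y k′ → k ≡ k′
Greedy-unique greedy-zero greedy-zero = refl
Greedy-unique greedy-zero (greedy-step ℓ Qℓ≤0 _ _) = ⊥-elim (<⇒≱ (Q-pos ℓ) Qℓ≤0)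
Greedy-unique (greedy-step ℓ Qℓ≤0 _ _) greedy-zero = ⊥-elim (<⇒≱ (Q-pos ℓ) Qℓ≤0)
Greedy-unique (greedy-step ℓ Qℓ≤y y<Qℓ+1 g) (greedy-step ℓ′ Qℓ′≤y y<Qℓ′+1 g′)
  with Q-bracket-unique {ℓ = ℓ} {ℓ′} Qℓ≤y y<Qℓ+1 Qℓ′≤y y<Qℓ′+1
... | refl = cong suc (Greedy-unique g g′)

Greedy-exists : ∀ y → ∃[ k ] Greedy y k
Greedy-exists = <-rec (λ y → ∃[ k ] Greedy y k) step
  where
  step : ∀ y → (∀ {y′} → y′ < y → ∃[ k ] Greedy y′ k) → ∃[ k ] Greedy y k
  step zero _ = 0 , greedy-zero
  step (suc y) rec with Q-bracket (suc y) (s≤s z≤n)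
  ... | ℓ , Qℓ≤y , y<Qℓ+1 with rec (∸-monoʳ-< (Q-pos ℓ) Qℓ≤y)
  ...   | k , g = suc k , greedy-step ℓ Qℓ≤y y<Qℓ+1 g

Greedy-Q : ∀ j → Greedy (Q j) 1
Greedy-Q j = greedy-step j ≤-refl (Q-<-suc j) (subst (λ y → Greedy y 0) (sym (n∸n≡0 (Q j))) greedy-zero)

Greedy-6 : Greedy 6 2
Greedy-6 = greedy-step 4 (n≤1+n 5) ≤-refl (Greedy-Q 0)

-- Adding one summand raises the greedy count by at most one

data Carry (p j : ℕ) : Set where
  one-term  : ∀ a → Q p + Q j ≡ Q a → Carry p j
  two-terms : ∀ a b → b < p → Q p + Q j ≡ Q a + Q b → Carry p j

carry+0 : ∀ p → Carry p p
carry+0 0 = one-term 1 refl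
carry+0 1 = one-term 3 refl
carry+0 2 = two-terms 3 1 (s<s z<s) refl
carry+0 3 = two-terms 5 0 z<s refl
carry+0 4 = two-terms 6 0 z<s refl
carry+0 5 = two-terms 7 1 (s<s z<s) refl
carry+0 (suc (suc (suc (suc (suc (suc n)))))) =
  two-terms (8 + n) (1 + n) (s<s (m<n+m n z<s)) (Q[6+n]+Q[6+n]≡Q[8+n]+Q[1+n] n)

carry+1 : ∀ p → Carry p (1 + p)
carry+1 0 = one-term 2 refl
carry+1 (suc n) = one-term (4 + n) (+-comm (Q (1 + n)) (Q (2 + n)))

carry+2 : ∀ p → Carry p (2 + p)
carry+2 0 = one-term 3 refl
carry+2 1 = two-terms 4 0 z<s refl
carry+2 2 = two-terms 5 0 z<s refl
carry+2 3 = two-terms 6 1 (s<s z<s) refl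
carry+2 (suc (suc (suc (suc n)))) =
  two-terms (7 + n) (1 + n) (s<s (m<n+m n z<s)) (Q[4+n]+Q[6+n]≡Q[7+n]+Q[1+n] n)

carry+3 : ∀ p → Carry p (3 + p)
carry+3 0 = one-term 4 refl
carry+3 1 = one-term 5 refl
carry+3 2 = two-terms 6 0 z<s refl
carry+3 3 = two-terms 7 0 z<s refl
carry+3 4 = two-terms 8 0 z<s refl
carry+3 5 = two-terms 9 1 (s<s z<s) refl
carry+3 (suc (suc (suc (suc (suc (suc n)))))) =
  two-terms (10 + n) (1 + n) (s<s (m<n+m n z<s)) (Q[6+n]+Q[9+n]≡Q[10+n]+Q[1+n] n)

carry+4 : ∀ p → Carry (suc p) (5 + p)
carry+4 p = one-term (6 + p) (trans (+-comm (Q (1 + p)) (Q (5 + p))) (sym (Q[6+n]≡Q[5+n]+Q[1+n] p)))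

-- Q 0 + Q 4 = 6 has no carry (its second term would need index below 0); then x = 1 and the
-- greedy count of 6 is read off directly.
data AddCase : ℕ → ℕ → Set where
  carry         : ∀ {p j} → Carry p j → AddCase p j
  one-plus-five : AddCase 0 4
  far           : ∀ {p} n → p ≤ n → AddCase p (5 + n)

addCase-above : ∀ p d → AddCase p (d + p)
addCase-above p 0 = carry (carry+0 p)
addCase-above p 1 = carry (carry+1 p)
addCase-above p 2 = carry (carry+2 p)
addCase-above p 3 = carry (carry+3 p)
addCase-above 0 4 = one-plus-five
addCase-above (suc p) 4 = carry (carry+4 p)
addCase-above p (suc (suc (suc (suc (suc e))))) = far (e + p) (m≤n+m p e)

addCase : ∀ p j → AddCase p j
addCase p j with j <? p
... | yes j<p = carry (two-terms p j j<p refl)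
... | no j≮p with m≤n⇒∃[o]m+o≡n (≮⇒≥ j≮p)
...   | d , refl = subst (AddCase p) (+-comm d p) (addCase-above p d)

Q-far : ∀ {x p n} → x < Q (suc p) → p ≤ n → x + Q (5 + n) < Q (6 + n)
Q-far {x} {p} {n} x<Qp+1 p≤n = begin-strict
  x + Q (5 + n)         <⟨ +-monoˡ-< (Q (5 + n)) (<-≤-trans x<Qp+1 (Q-mono (s≤s p≤n))) ⟩
  Q (1 + n) + Q (5 + n) ≡⟨ +-comm (Q (1 + n)) (Q (5 + n)) ⟩
  Q (5 + n) + Q (1 + n) ≡⟨ Q[6+n]≡Q[5+n]+Q[1+n] n ⟨
  Q (6 + n)             ∎
  where open ≤-Reasoning

GreedyAddQ : ℕ → Set
GreedyAddQ x = ∀ j {k k′} → Greedy x k → Greedy (x + Q j) k′ → k′ ≤ suc k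

Greedy-+carry : ∀ {x p j k₀ k′} → (∀ {y} → y < x → GreedyAddQ y) →
                Q p ≤ x → Greedy (x ∸ Q p) k₀ → Carry p j → Greedy (x + Q j) k′ → k′ ≤ 2 + k₀
Greedy-+carry {x} {p} {j} {k₀} {k′} ih Qp≤x g₀ c gy = by-carry c
  where
  x′ = x ∸ Q p
  Qp+x′≡x : Q p + x′ ≡ x
  Qp+x′≡x = m+[n∸m]≡n Qp≤x
  regroup : ∀ {y} → Q p + Q j ≡ y → x + Q j ≡ x′ + y
  regroup {y} e = begin
    x + Q j          ≡⟨ cong (_+ Q j) (trans (sym Qp+x′≡x) (+-comm (Q p) x′)) ⟩
    x′ + Q p + Q j   ≡⟨ +-assoc x′ (Q p) (Q j) ⟩
    x′ + (Q p + Q j) ≡⟨ cong (x′ +_) e ⟩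
    x′ + y           ∎
    where open ≡-Reasoning
  by-carry : Carry p j → k′ ≤ 2 + k₀
  by-carry (one-term a e) =
    m≤n⇒m≤1+n (ih (∸-monoʳ-< (Q-pos p) Qp≤x) a g₀ (subst (λ y → Greedy y k′) (regroup e) gy))
  by-carry (two-terms a b b<p e) with Greedy-exists (x′ + Q b)
  ... | k₁ , g₁ = ≤-trans (ih x′+Qb<x a g₁ gy′) (s≤s (ih (∸-monoʳ-< (Q-pos p) Qp≤x) b g₀ g₁))
    where
    x′+Qb<x : x′ + Q b < x
    x′+Qb<x =
      subst (x′ + Q b <_) (trans (+-comm x′ (Q p)) Qp+x′≡x) (+-monoʳ-< x′ (Q-strictMono b<p))
    gy′ : Greedy (x′ + Q b + Q a) k′
    gy′ = subst (λ y → Greedy y k′)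
            (trans (regroup e) (trans (cong (x′ +_) (+-comm (Q a) (Q b))) (sym (+-assoc x′ (Q b) (Q a)))))
            gy

Greedy-+Q : ∀ x j {k k′} → Greedy x k → Greedy (x + Q j) k′ → k′ ≤ suc k
Greedy-+Q = <-rec GreedyAddQ step
  where
  step : ∀ x → (∀ {y} → y < x → GreedyAddQ y) → GreedyAddQ x
  step _ _ j greedy-zero gy = ≤-reflexive (Greedy-unique gy (Greedy-Q j))
  step x ih j {k′ = k′} (greedy-step {k = k₀} p Qp≤x x<Qp+1 g₀) gy with addCase p j
  ... | carry c = Greedy-+carry ih Qp≤x g₀ c gy
  ... | one-plus-five = ≤-trans (≤-reflexive (Greedy-unique gy′ Greedy-6)) (m≤m+n 2 k₀)
    where
    gy′ : Greedy 6 k′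
    gy′ = subst (λ y → Greedy (y + 5) k′) (≤-antisym (s≤s⁻¹ x<Qp+1) Qp≤x) gy
  ... | far n p≤n =
    ≤-reflexive (Greedy-unique gy (greedy-step (5 + n) (m≤n+m (Q (5 + n)) x) (Q-far x<Qp+1 p≤n) gx))
    where
    gx : Greedy (x + Q (5 + n) ∸ Q (5 + n)) (suc k₀)
    gx = subst (λ y → Greedy y (suc k₀)) (sym (m+n∸n≡m x (Q (5 + n)))) (greedy-step p Qp≤x x<Qp+1 g₀)

-- Minimality of the greedy decomposition

Greedy-+c*Q : ∀ c s {x k k′} → Greedy x k → Greedy (c * Q s + x) k′ → k′ ≤ c + k
Greedy-+c*Q zero    s gx gy = ≤-reflexive (Greedy-unique gy gx)
Greedy-+c*Q (suc c) s {x} {k′ = k′} gx gy with Greedy-exists (c * Q s + x)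
... | k₁ , g₁ = ≤-trans (Greedy-+Q (c * Q s + x) s g₁ gy′) (s≤s (Greedy-+c*Q c s gx g₁))
  where
  gy′ : Greedy (c * Q s + x + Q s) k′
  gy′ = subst (λ y → Greedy y k′)
          (trans (+-assoc (Q s) (c * Q s) x) (+-comm (Q s) (c * Q s + x))) gy

Greedy-≤-sum : ∀ s cs {k} → Greedy (decValue Q s cs) k → k ≤ sum cs
Greedy-≤-sum s [] g = ≤-reflexive (Greedy-unique g greedy-zero)
Greedy-≤-sum s (c ∷ cs) g with Greedy-exists (decValue Q (suc s) cs)
... | k₁ , g₁ = ≤-trans (Greedy-+c*Q c s g₁ g) (+-monoʳ-≤ c (Greedy-≤-sum (suc s) cs g₁))

module _ {q : ℕ → ℕ} (q≗Q : ∀ n → q n ≡ Q n) where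

  decValue-≗ : ∀ s cs → decValue q s cs ≡ decValue Q s cs
  decValue-≗ s [] = refl
  decValue-≗ s (c ∷ cs) = cong₂ (λ a b → c * a + b) (q≗Q s) (decValue-≗ (suc s) cs)

  q-not-term : ∀ {y} ℓ → Q ℓ < y → y < Q (suc ℓ) → ∀ n → q n ≢ y
  q-not-term ℓ Qℓ<y y<Qℓ+1 n qn≡y with trans (sym (q≗Q n)) qn≡y
  ... | refl = <⇒≱ (Q-cancel-< ℓ n Qℓ<y) (s≤s⁻¹ (Q-cancel-< n (suc ℓ) y<Qℓ+1))

  Greedy⇒Greedy6 : ∀ {y k} → Greedy y k → 0 < y → Greedy6 q y k
  Greedy⇒Greedy6 greedy-zero ()
  Greedy⇒Greedy6 (greedy-step {y} {k₀} ℓ Qℓ≤y y<Qℓ+1 g) _ with m≤n⇒m<n∨m≡n Qℓ≤y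
  ... | inj₂ Qℓ≡y = subst (Greedy6 q y ∘ suc) (Greedy-unique g₀ g) (g-term ℓ (trans (q≗Q ℓ) Qℓ≡y))
    where
    g₀ : Greedy (y ∸ Q ℓ) 0
    g₀ = subst (λ z → Greedy z 0) (sym (trans (cong (y ∸_) Qℓ≡y) (n∸n≡0 y))) greedy-zero
  ... | inj₁ Qℓ<y with y ≟ 6
  ...   | yes refl = subst (Greedy6 q 6) (Greedy-unique Greedy-6 (greedy-step ℓ Qℓ≤y y<Qℓ+1 g))
                       (g-six (q-not-term ℓ Qℓ<y y<Qℓ+1))
  ...   | no y≢6 = g-step ℓ (q-not-term ℓ Qℓ<y y<Qℓ+1) y≢6
                     (subst (_< y) (sym (q≗Q ℓ)) Qℓ<y) (subst (y <_) (sym (q≗Q (suc ℓ))) y<Qℓ+1)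
                     (subst (λ z → Greedy6 q (y ∸ z) k₀) (sym (q≗Q ℓ))
                       (Greedy⇒Greedy6 g (m<n⇒0<n∸m Qℓ<y)))

-- No FQ-legal sum of earlier terms is a term

bitSum : (ℕ → Bool) → ℕ → ℕ
bitSum s zero = 0
bitSum s (suc n) = bitSum s n + (if s n then Q n else 0)

bitSum-off : ∀ s n → s n ≡ false → bitSum s (suc n) ≡ bitSum s n
bitSum-off s n sn≡false rewrite sn≡false = +-identityʳ (bitSum s n)

bitSum-on : ∀ s n → s n ≡ true → bitSum s (suc n) ≡ bitSum s n + Q n
bitSum-on s n sn≡true rewrite sn≡true = refl

data TopBit (s : ℕ → Bool) (n : ℕ) : Set where
  on  : s n ≡ true  → bitSum s (suc n) ≡ bitSum s n + Q n → TopBit s n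
  off : s n ≡ false → bitSum s (suc n) ≡ bitSum s n       → TopBit s n

topBit : ∀ s n → TopBit s n
topBit s n with s n in e
... | true  = on e (bitSum-on s n e)
... | false = off e (bitSum-off s n e)

bitSum-1≤1 : ∀ s → bitSum s 1 ≤ 1
bitSum-1≤1 s with topBit s 0
... | on _ eq  = ≤-reflexive eq
... | off _ eq = ≤-trans (≤-reflexive eq) z≤n

bitSum<Q[2+n] : ∀ {s} → (∀ a → s (1 + a) ≡ true → s a ≡ false) → ∀ n → bitSum s n < Q (2 + n)
bitSum<Q[2+n] gap1 0 = z<s
bitSum<Q[2+n] {s} gap1 1 = <-≤-trans (s≤s (bitSum-1≤1 s)) (s≤s (s≤s z≤n))
-- The recursive results are passed to by-top from the clause body, where the termination
-- checker sees them decrease; called from inside the where block they would not be.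
bitSum<Q[2+n] {s} gap1 (suc (suc n)) =
  by-top (topBit s (suc n)) (bitSum<Q[2+n] gap1 (suc n)) (bitSum<Q[2+n] gap1 n)
  where
  open ≤-Reasoning
  by-top : TopBit s (suc n) → bitSum s (1 + n) < Q (3 + n) → bitSum s n < Q (2 + n) →
           bitSum s (2 + n) < Q (4 + n)
  by-top (off _ eq) ih₁ _ = begin-strict
    bitSum s (2 + n) ≡⟨ eq ⟩
    bitSum s (1 + n) <⟨ <-trans ih₁ (Q-<-suc (3 + n)) ⟩
    Q (4 + n)        ∎
  by-top (on e eq) _ ih₀ = begin-strict
    bitSum s (2 + n)             ≡⟨ eq ⟩
    bitSum s (1 + n) + Q (1 + n) ≡⟨ cong (_+ Q (1 + n)) (bitSum-off s n (gap1 n e)) ⟩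
    bitSum s n + Q (1 + n)       <⟨ +-monoˡ-< (Q (1 + n)) ih₀ ⟩
    Q (4 + n)                    ∎

record LegalBits (s : ℕ → Bool) : Set where
  field
    gap1    : ∀ a → s (1 + a) ≡ true → s a ≡ false
    gap3    : ∀ a → s (3 + a) ≡ true → s a ≡ false
    gap4    : ∀ a → s (4 + a) ≡ true → s a ≡ false
    gap-0-2 : s 2 ≡ true → s 0 ≡ false

module _ {s : ℕ → Bool} (legal : LegalBits s) where
  open LegalBits legal

  bitSum[1+n]≤Q[n] : ∀ n → n < 3 → bitSum s (suc n) ≤ Q n
  bitSum[1+n]≤Q[n] 0 _ = bitSum-1≤1 s
  bitSum[1+n]≤Q[n] 1 _ with topBit s 1
  ... | on e eq  = ≤-reflexive (trans eq (cong (_+ 2) (bitSum-off s 0 (gap1 0 e))))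
  ... | off _ eq = ≤-trans (≤-reflexive eq) (m≤n⇒m≤1+n (bitSum-1≤1 s))
  bitSum[1+n]≤Q[n] 2 _ with topBit s 2
  ... | on e eq  =
    ≤-reflexive (trans eq (cong (_+ 3) (trans (bitSum-off s 1 (gap1 1 e)) (bitSum-off s 0 (gap-0-2 e)))))
  ... | off _ eq = ≤-trans (≤-reflexive eq) (m≤n⇒m≤1+n (bitSum[1+n]≤Q[n] 1 (s<s z<s)))
  bitSum[1+n]≤Q[n] (suc (suc (suc _))) (s<s (s<s (s<s ())))

  legal-bitSum≢Q : ∀ i → bitSum s i ≢ Q i
  bitSum+Q[3+n]≢Q[4+n] : ∀ n → s (3 + n) ≡ true → bitSum s n + Q (3 + n) ≢ Q (4 + n)

  legal-bitSum≢Q 0 = λ ()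
  legal-bitSum≢Q 1 = <⇒≢ (≤-<-trans (bitSum[1+n]≤Q[n] 0 z<s) (Q-<-suc 0))
  legal-bitSum≢Q 2 = <⇒≢ (≤-<-trans (bitSum[1+n]≤Q[n] 1 (s<s z<s)) (Q-<-suc 1))
  legal-bitSum≢Q 3 = <⇒≢ (≤-<-trans (bitSum[1+n]≤Q[n] 2 (s<s (s<s z<s))) (Q-<-suc 2))
  legal-bitSum≢Q (suc (suc (suc (suc n)))) =
    by-top (topBit s (3 + n)) (legal-bitSum≢Q (suc n)) (bitSum+Q[3+n]≢Q[4+n] n)
    where
    by-top : TopBit s (3 + n) → bitSum s (1 + n) ≢ Q (1 + n) →
             (s (3 + n) ≡ true → bitSum s n + Q (3 + n) ≢ Q (4 + n)) → bitSum s (4 + n) ≢ Q (4 + n)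
    by-top (off _ eq₃) ih _ with topBit s (2 + n)
    ... | off _ eq₂ = <⇒≢ (subst (_< Q (4 + n)) (sym (trans eq₃ eq₂)) (bitSum<Q[2+n] gap1 (2 + n)))
    ... | on e₂ eq₂ = λ h →
      ih (+-cancelʳ-≡ (Q (2 + n)) _ _ (trans (sym sum≡) (trans h (+-comm (Q (2 + n)) (Q (1 + n))))))
      where
      sum≡ : bitSum s (4 + n) ≡ bitSum s (1 + n) + Q (2 + n)
      sum≡ = trans eq₃ (trans eq₂ (cong (_+ Q (2 + n)) (bitSum-off s (1 + n) (gap1 (1 + n) e₂))))
    by-top (on e₃ eq₃) _ tail with topBit s (1 + n)
    ... | off _ eq₁ = λ h → tail e₃ (trans (sym sum≡) h)
      where
      sum≡ : bitSum s (4 + n) ≡ bitSum s n + Q (3 + n)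
      sum≡ = trans eq₃ (cong (_+ Q (3 + n))
               (trans (bitSum-off s (2 + n) (gap1 (2 + n) e₃)) (trans eq₁ (bitSum-off s n (gap3 n e₃)))))
    ... | on _ eq₁ = >⇒≢ (begin-strict
      Q (4 + n)
        ≡⟨ +-comm (Q (2 + n)) (Q (1 + n)) ⟩
      Q (1 + n) + Q (2 + n)
        <⟨ +-monoʳ-< (Q (1 + n)) (Q-<-suc (2 + n)) ⟩
      Q (1 + n) + Q (3 + n)
        ≤⟨ +-monoˡ-≤ (Q (3 + n)) (m≤n+m (Q (1 + n)) (bitSum s (1 + n))) ⟩
      bitSum s (1 + n) + Q (1 + n) + Q (3 + n)
        ≡⟨ cong (_+ Q (3 + n)) (sym (trans (bitSum-off s (2 + n) (gap1 (2 + n) e₃)) eq₁)) ⟩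
      bitSum s (3 + n) + Q (3 + n)
        ≡⟨ sym eq₃ ⟩
      bitSum s (4 + n) ∎)
      where open ≤-Reasoning

  bitSum+Q[3+n]≢Q[4+n] 0 _ = λ ()
  bitSum+Q[3+n]≢Q[4+n] 1 _ h = <⇒≢ (s≤s (bitSum-1≤1 s)) (+-cancelʳ-≡ 5 _ _ h)
  bitSum+Q[3+n]≢Q[4+n] (suc (suc m)) e₅ h =
    legal-bitSum≢Q (suc m) (+-cancelʳ-≡ (Q (5 + m)) _ _ (begin
      bitSum s (1 + m) + Q (5 + m) ≡⟨ cong (_+ Q (5 + m)) (bitSum-off s (1 + m) (gap4 (1 + m) e₅)) ⟨
      bitSum s (2 + m) + Q (5 + m) ≡⟨ h ⟩
      Q (6 + m)                    ≡⟨ Q[6+n]≡Q[5+n]+Q[1+n] m ⟩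
      Q (5 + m) + Q (1 + m)        ≡⟨ +-comm (Q (5 + m)) (Q (1 + m)) ⟩
      Q (1 + m) + Q (5 + m)        ∎))
    where open ≡-Reasoning

bitSum-cong : ∀ {s t} n → (∀ {k} → k < n → s k ≡ t k) → bitSum s n ≡ bitSum t n
bitSum-cong zero _ = refl
bitSum-cong (suc n) s≗t =
  cong₂ (λ a b → a + (if b then Q n else 0)) (bitSum-cong n (s≗t ∘ m<n⇒m<1+n)) (s≗t ≤-refl)

insertBit : ℕ → (ℕ → Bool) → ℕ → Bool
insertBit x s k = does (k ≟ x) ∨ s k

insertBit-≢ : ∀ {x s k} → k ≢ x → insertBit x s k ≡ s k
insertBit-≢ {x} {s} {k} k≢x = cong (_∨ s k) (dec-false (k ≟ x) k≢x)

bitSum-insertBit : ∀ {s x} n → s x ≡ false → x < n → bitSum (insertBit x s) n ≡ Q x + bitSum s n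
bitSum-insertBit {s} {x} (suc n) sx≡false (s≤s x≤n) with m≤n⇒m<n∨m≡n x≤n
... | inj₁ x<n = begin
  bitSum (insertBit x s) n + (if insertBit x s n then Q n else 0)
    ≡⟨ cong₂ (λ a b → a + (if b then Q n else 0))
             (bitSum-insertBit n sx≡false x<n) (insertBit-≢ {s = s} (>⇒≢ x<n)) ⟩
  Q x + bitSum s n + (if s n then Q n else 0)
    ≡⟨ +-assoc (Q x) (bitSum s n) _ ⟩
  Q x + bitSum s (suc n) ∎
  where open ≡-Reasoning
... | inj₂ refl = begin
  bitSum (insertBit x s) (suc x)
    ≡⟨ bitSum-on (insertBit x s) x (cong (_∨ s x) (dec-true (x ≟ x) refl)) ⟩
  bitSum (insertBit x s) x + Q x
    ≡⟨ cong (_+ Q x) (bitSum-cong x (λ k<x → insertBit-≢ {s = s} (<⇒≢ k<x))) ⟩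
  bitSum s x + Q x               ≡⟨ +-comm (bitSum s x) (Q x) ⟩
  Q x + bitSum s x               ≡⟨ cong (Q x +_) (bitSum-off s x sx≡false) ⟨
  Q x + bitSum s (suc x)         ∎
  where open ≡-Reasoning

bitSum-false : ∀ n → bitSum (λ _ → false) n ≡ 0
bitSum-false zero = refl
bitSum-false (suc n) = trans (+-identityʳ _) (bitSum-false n)

bits : List ℕ → ℕ → Bool
bits L k = does (k ∈? L)

bits-∈ : ∀ {L x} → bits L x ≡ true → x ∈ L
bits-∈ {L} {x} e with x ∈? L
... | yes x∈L = x∈L

AllPairs-∈ : ∀ {A : Set} {R : A → A → Set} {L x y} →
             AllPairs R L → x ∈ L → y ∈ L → x ≢ y → R x y ⊎ R y x
AllPairs-∈ (_ ∷ _) (here refl) (here refl) x≢y = ⊥-elim (x≢y refl)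
AllPairs-∈ (Rx ∷ _) (here refl) (there y∈L) _ = inj₁ (All.lookup Rx y∈L)
AllPairs-∈ (Rx ∷ _) (there x∈L) (here refl) _ = inj₂ (All.lookup Rx x∈L)
AllPairs-∈ (_ ∷ apart) (there x∈L) (there y∈L) x≢y = AllPairs-∈ apart x∈L y∈L x≢y

GoodGap-sym : ∀ {a b} → GoodGap a b → GoodGap b a
GoodGap-sym {a} {b} (g0 , g1 , g3 , g4) = flip g0 , flip g1 , flip g3 , flip g4
  where
  flip : ∀ {c} → ∣ a - b ∣ ≢ c → ∣ b - a ∣ ≢ c
  flip g e = g (trans (∣-∣-comm a b) e)

module _ {L : List ℕ} (apart : AllPairs GoodGap L) where

  GoodGap-∈ : ∀ {x y} → x ∈ L → y ∈ L → x ≢ y → GoodGap x y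
  GoodGap-∈ {x} {y} x∈L y∈L x≢y with AllPairs-∈ apart x∈L y∈L x≢y
  ... | inj₁ gap = gap
  ... | inj₂ gap = GoodGap-sym {y} {x} gap

  bits-gap : ∀ d → 0 < d → (∀ {x y} → GoodGap x y → ∣ x - y ∣ ≢ d) →
             ∀ a → bits L (d + a) ≡ true → bits L a ≡ false
  bits-gap d 0<d gap≢d a e = dec-false (a ∈? L) λ a∈L →
    gap≢d {a} {d + a} (GoodGap-∈ a∈L (bits-∈ e) (<⇒≢ (m<n+m a 0<d)))
                      (trans (cong (∣ a -_∣) (+-comm d a)) (∣m-m+n∣≡n a d))

  legalBits : ¬ (0 ∈ L × 2 ∈ L) → LegalBits (bits L)
  legalBits no-0-2 = record
    { gap1    = bits-gap 1 z<s (proj₁ ∘ proj₂)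
    ; gap3    = bits-gap 3 z<s (proj₁ ∘ proj₂ ∘ proj₂)
    ; gap4    = bits-gap 4 z<s (proj₂ ∘ proj₂ ∘ proj₂)
    ; gap-0-2 = λ e → dec-false (0 ∈? L) (λ 0∈L → no-0-2 (0∈L , bits-∈ e))
    }

sum-map-Q≡bitSum : ∀ {L i} → AllPairs GoodGap L → All (_< i) L → sum (map Q L) ≡ bitSum (bits L) i
sum-map-Q≡bitSum {[]} {i} [] [] = sym (bitSum-false i)
sum-map-Q≡bitSum {x ∷ L} {i} (x-apart ∷ apart) (x<i ∷ below) = begin
  Q x + sum (map Q L)        ≡⟨ cong (Q x +_) (sum-map-Q≡bitSum apart below) ⟩
  Q x + bitSum (bits L) i    ≡⟨ bitSum-insertBit i x∉L x<i ⟨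
  bitSum (bits (x ∷ L)) i    ∎
  where
  open ≡-Reasoning
  x∉L : bits L x ≡ false
  x∉L = dec-false (x ∈? L) λ x∈L → proj₁ (All.lookup x-apart x∈L) (∣n-n∣≡0 x)

legal-sum≢Q : ∀ {i L} → All (_< i) L → FQLegal L → sum (map Q L) ≢ Q i
legal-sum≢Q {i} below (apart , no-0-2) sum≡Q =
  legal-bitSum≢Q (legalBits apart no-0-2) i (trans (sym (sum-map-Q≡bitSum apart below)) sum≡Q)

-- FQ-legal decompositions exist

GoodGap-far : ∀ {a b} → 5 + b ≤ a → GoodGap a b
GoodGap-far {a} {b} 5+b≤a = ≢c z<s , ≢c (s<s z<s) , ≢c (s<s (s<s (s<s z<s))) , ≢c ≤-refl
  where
  5≤∣a-b∣ : 5 ≤ ∣ a - b ∣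
  5≤∣a-b∣ = subst (5 ≤_) (sym (m≤n⇒∣n-m∣≡n∸m (m+n≤o⇒n≤o 5 5+b≤a))) (m+n≤o⇒m≤o∸n 5 5+b≤a)
  ≢c : ∀ {c} → c < 5 → ∣ a - b ∣ ≢ c
  ≢c c<5 e = <⇒≱ c<5 (subst (5 ≤_) e 5≤∣a-b∣)

LegalDecomposition : ℕ → Set
LegalDecomposition m = Σ (List ℕ) λ L → All (λ x → Q x ≤ m) L × FQLegal L × sum (map Q L) ≡ m

extend-legal : ∀ n {r} → r < Q (1 + n) → LegalDecomposition r → LegalDecomposition (Q (5 + n) + r)
extend-legal n {r} r<Q[1+n] (L , bounded , (apart , no-0-2) , sum≡r) =
  5 + n ∷ L ,
  m≤m+n (Q (5 + n)) r ∷ All.map (λ Qx≤r → ≤-trans Qx≤r (m≤n+m r (Q (5 + n)))) bounded ,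
  (All.map (λ {x} → apart-from-top {x}) bounded ∷ apart , no-0-2′) ,
  cong (Q (5 + n) +_) sum≡r
  where
  apart-from-top : ∀ {x} → Q x ≤ r → GoodGap (5 + n) x
  apart-from-top {x} Qx≤r =
    GoodGap-far (+-monoʳ-≤ 5 (s≤s⁻¹ (Q-cancel-< x (1 + n) (≤-<-trans Qx≤r r<Q[1+n]))))
  no-0-2′ : ¬ (0 ∈ 5 + n ∷ L × 2 ∈ 5 + n ∷ L)
  no-0-2′ (here () , _)
  no-0-2′ (there _ , here ())
  no-0-2′ (there 0∈L , there 2∈L) = no-0-2 (0∈L , 2∈L)

non-term-index≥5 : ∀ {m} ℓ → Q ℓ < m → m < Q (suc ℓ) → m ≢ 6 → ∃[ n ] ℓ ≡ 5 + n
non-term-index≥5 0 Qℓ<m m<Qℓ+1 _ = ⊥-elim (<⇒≱ Qℓ<m (s≤s⁻¹ m<Qℓ+1))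
non-term-index≥5 1 Qℓ<m m<Qℓ+1 _ = ⊥-elim (<⇒≱ Qℓ<m (s≤s⁻¹ m<Qℓ+1))
non-term-index≥5 2 Qℓ<m m<Qℓ+1 _ = ⊥-elim (<⇒≱ Qℓ<m (s≤s⁻¹ m<Qℓ+1))
non-term-index≥5 3 Qℓ<m m<Qℓ+1 _ = ⊥-elim (<⇒≱ Qℓ<m (s≤s⁻¹ m<Qℓ+1))
non-term-index≥5 4 Qℓ<m m<Qℓ+1 m≢6 = ⊥-elim (m≢6 (≤-antisym (s≤s⁻¹ m<Qℓ+1) Qℓ<m))
non-term-index≥5 (suc (suc (suc (suc (suc n))))) _ _ _ = n , refl

legal-Q : ∀ ℓ → LegalDecomposition (Q ℓ)
legal-Q ℓ = ℓ ∷ [] , ≤-refl ∷ [] , ([] ∷ [] , λ { (here refl , here ()) }) , +-identityʳ (Q ℓ)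

legal-6 : LegalDecomposition 6
legal-6 = 3 ∷ 1 ∷ [] , m≤m+n 4 2 ∷ m≤m+n 2 4 ∷ [] , (apart ∷ [] ∷ [] , no-0-2) , refl
  where
  apart : All (GoodGap 3) (1 ∷ [])
  apart = ((λ ()) , (λ ()) , (λ ()) , (λ ())) ∷ []
  no-0-2 : ¬ (0 ∈ 3 ∷ 1 ∷ [] × 2 ∈ 3 ∷ 1 ∷ [])
  no-0-2 (here () , _)
  no-0-2 (there (here ()) , _)

legal-decomposition : ∀ m → 0 < m → LegalDecomposition m
legal-decomposition = <-rec (λ m → 0 < m → LegalDecomposition m) step
  where
  step : ∀ m → (∀ {r} → r < m → 0 < r → LegalDecomposition r) → 0 < m → LegalDecomposition m
  step m rec 0<m with Q-bracket m 0<m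
  ... | ℓ , Qℓ≤m , m<Qℓ+1 with Q ℓ ≟ m | m ≟ 6
  ... | yes Qℓ≡m | _ = subst LegalDecomposition Qℓ≡m (legal-Q ℓ)
  ... | no _ | yes refl = legal-6
  ... | no Qℓ≢m | no m≢6 with non-term-index≥5 ℓ (≤∧≢⇒< Qℓ≤m Qℓ≢m) m<Qℓ+1 m≢6
  ...   | n , refl = subst LegalDecomposition (m+[n∸m]≡n Qℓ≤m) (extend-legal n r<Q[1+n] (rec r<m 0<r))
    where
    r<m : m ∸ Q (5 + n) < m
    r<m = ∸-monoʳ-< (Q-pos (5 + n)) Qℓ≤m
    0<r : 0 < m ∸ Q (5 + n)
    0<r = m<n⇒0<n∸m (≤∧≢⇒< Qℓ≤m Qℓ≢m)
    r<Q[1+n] : m ∸ Q (5 + n) < Q (1 + n)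
    r<Q[1+n] = subst (m ∸ Q (5 + n) <_) (m+n∸m≡n (Q (5 + n)) (Q (1 + n)))
                 (∸-monoˡ-< (subst (m <_) (Q[6+n]≡Q[5+n]+Q[1+n] n) m<Qℓ+1) Qℓ≤m)

-- Q is the Fibonacci Quilt sequence

sum-map-cong : ∀ {f g : ℕ → ℕ} {L} → All (λ x → f x ≡ g x) L → sum (map f L) ≡ sum (map g L)
sum-map-cong [] = refl
sum-map-cong (fx≡gx ∷ rest) = cong₂ _+_ fx≡gx (sum-map-cong rest)

FibonacciQuilt≗Q : ∀ {q} → IsFibonacciQuilt q → ∀ n → q n ≡ Q n
FibonacciQuilt≗Q {q} isFQ = <-rec (λ n → q n ≡ Q n) step
  where
  step : ∀ i → (∀ {j} → j < i → q j ≡ Q j) → q i ≡ Q i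
  step i ih with isFQ i
  ... | 0<qi , no-decomposition , decomposable with <-cmp (q i) (Q i)
  ...   | tri≈ _ qi≡Qi _ = qi≡Qi
  ...   | tri< qi<Qi _ _ with legal-decomposition (q i) 0<qi
  ...     | L , bounded , legal , sum≡qi = ⊥-elim (no-decomposition (L , below , legal , sum-q≡qi))
    where
    below : All (_< i) L
    below = All.map (λ {x} Qx≤qi → Q-cancel-< x i (≤-<-trans Qx≤qi qi<Qi)) bounded
    sum-q≡qi : sum (map q L) ≡ q i
    sum-q≡qi = trans (sum-map-cong (All.map ih below)) sum≡qi
  step i ih | _ , _ , decomposable | tri> _ _ Qi<qi with decomposable (Q i) (Q-pos i) Qi<qi
  ...     | L , below , legal , sum≡Qi =
    ⊥-elim (legal-sum≢Q below legal (trans (sym (sum-map-cong (All.map ih below))) sum≡Qi))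

theorem1p16 : (q : ℕ → ℕ) → IsFibonacciQuilt q →
    (m : ℕ) → 0 < m →
    ∃[ k ] (Greedy6 q m k ×
      ((c : List ℕ) → decValue q 0 c ≡ m → k ≤ sum c))
theorem1p16 q isFQ m 0<m with Greedy-exists m
... | k , greedy = k , Greedy⇒Greedy6 q≗Q greedy 0<m , minimal
  where
  q≗Q : ∀ n → q n ≡ Q n
  q≗Q = FibonacciQuilt≗Q isFQ
  minimal : (c : List ℕ) → decValue q 0 c ≡ m → k ≤ sum c
  minimal c value≡m =
    Greedy-≤-sum 0 c (subst (λ y → Greedy y k) (trans (sym value≡m) (decValue-≗ q≗Q 0 c)) greedy)
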